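{- Let $p\ge 1600$ be a prime. Fix integers $a_1$, $r_2$, $r_3$. Consider pairs of integers $(a_2,a_3)$ with $a_2\equiv r_2\pmod p$, $a_3\equiv r_3 \pmod p$ and $-20p^{3/2}\le a_3\le 20p^{3/2}$. Then distinct such pairs $(a_2,a_3)$ give distinct values of $$N(a_2,a_3)=p^3+1+a_1(p^2+1)+a_2(p+1)+a_3.$$ Consequently, for a genus $3$ curve $C/\mathbb{F}_p$ with known $a_1$ and known $a_2\bmod p$, $a_3\bmod p$, the group order $\#J(C)(\mathbb{F}_p)$ uniquely determines the triple $(a_1,a_2,a_3)$.
   Context: For a genus $3$ curve $C$ over $\mathbb{F}_p$ with $L$-polynomial $L_p(T)=p^3T^6+p^2a_1T^5+pa_2T^4+a_3T^3+a_2T^2+a_1T+1$, we have $\#J(C)(\mathbb{F}_p)=L_p(1)=p^3+1+a_1(p^2+1)+a_2(p+1)+a_3$. The Hasse–Weil bound gives $|a_3|\le 20p^{3/2}$. Here $J(C)$ denotes the Jacobian of $C$. -}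

module Defs where

open import Data.Nat using (ℕ; _≤_; _^_; _*_)
open import Data.Integer as ℤ using (ℤ; +_; _-_; ∣_∣)
open import Data.Integer.Divisibility using (_∣_)
open import Data.Product using (_×_)

N : ℕ → ℤ → ℤ → ℤ → ℤ
N p a₁ a₂ a₃ =
  (+ p) ℤ.^ 3 ℤ.+ + 1 ℤ.+ a₁ ℤ.* ((+ p) ℤ.^ 2 ℤ.+ + 1)
    ℤ.+ a₂ ℤ.* (+ p ℤ.+ + 1) ℤ.+ a₃

-- |a₃| ≤ 20 p^{3/2}, stated exactly (both sides nonnegative) as |a₃|² ≤ 400 p³
HasseBound : ℕ → ℤ → Set
HasseBound p a₃ = ∣ a₃ ∣ ^ 2 ≤ 400 * p ^ 3

Admissible : ℕ → ℤ → ℤ → ℤ → ℤ → Set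
Admissible p r₂ r₃ a₂ a₃ =
  ((+ p) ∣ (a₂ - r₂)) × ((+ p) ∣ (a₃ - r₃)) × HasseBound p a₃

{-# OPTIONS --safe #-}
-- Two admissible pairs with the same N satisfy (a₂ − b₂)(p + 1) = b₃ − a₃.  As p divides
-- a₂ − b₂, a nonzero difference would force |a₃ − b₃| ≥ p(p + 1), whereas the Hasse–Weil
-- bound gives |a₃ − b₃| ≤ 40 p^{3/2}, and 40 p^{3/2} < p(p + 1) as soon as p ≥ 1600.
module Submission where

open import Defs
open import Data.Nat using (ℕ; _≤_)
open import Data.Nat.Primality using (Prime)
open import Data.Integer using (ℤ)
open import Data.Product using (_×_)
open import Relation.Binary.PropositionalEquality using (_≡_)

open import Data.Nat using (zero; suc; NonZero; _+_; _*_; _^_; _<_)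
open import Data.Nat.Properties
  using (≤-total; ≰⇒>; <⇒≱; *-assoc; +-comm; +-monoˡ-≤; *-monoʳ-≤; *-monoˡ-≤;
         *-monoʳ-<; *-cancelʳ-<; ^-monoˡ-≤; ^-monoˡ-<; n<1+n; module ≤-Reasoning)
open import Data.Nat.Divisibility as ℕ using (>⇒∤)
open import Data.Nat.Tactic.RingSolver as ℕ-Solver using ()
open import Data.Integer as ℤ using (+_; _-_; ∣_∣; 0ℤ)
open import Data.Integer.Properties
  using (∣i-j∣≤∣i∣+∣j∣; ∣i∣≡0⇒i≡0; i≡j⇒i-j≡0; i-j≡0⇒i≡j; abs-*; +-identityʳ)
open import Data.Integer.Divisibility using () renaming (_∣_ to _∣ℤ_)
open import Data.Integer.Divisibility.Signed using (∣ᵤ⇒∣; ∣⇒∣ᵤ; ∣m∣n⇒∣m-n)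
  renaming (_∣_ to _∣ₛ_)
open import Data.Integer.Tactic.RingSolver as ℤ-Solver using ()
open import Data.Product using (_,_)
open import Data.Sum using (inj₁; inj₂)
open import Relation.Nullary using (contradiction)
open import Relation.Binary.PropositionalEquality
  using (refl; sym; trans; cong; subst; module ≡-Reasoning)

^-cancelˡ-< : ∀ n {m o} → m ^ n < o ^ n → m < o
^-cancelˡ-< n mⁿ<oⁿ = ≰⇒> λ o≤m → <⇒≱ mⁿ<oⁿ (^-monoˡ-≤ n o≤m)

-- The ring solver rejects ℕ-exponentiation, so its goals below have _^_ unfolded.

x≤y∧y²≤c⇒[x+y]²≤4c : ∀ {x y c} → x ≤ y → y ^ 2 ≤ c → (x + y) ^ 2 ≤ 4 * c
x≤y∧y²≤c⇒[x+y]²≤4c {x} {y} {c} x≤y y²≤c = begin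
  (x + y) ^ 2  ≤⟨ ^-monoˡ-≤ 2 (+-monoˡ-≤ y x≤y) ⟩
  (y + y) ^ 2  ≡⟨ double² y ⟩
  4 * y ^ 2    ≤⟨ *-monoʳ-≤ 4 y²≤c ⟩
  4 * c        ∎
  where
  open ≤-Reasoning
  double² : ∀ y → (y + y) * ((y + y) * 1) ≡ 4 * (y * (y * 1))
  double² = ℕ-Solver.solve-∀

x²≤c∧y²≤c⇒[x+y]²≤4c : ∀ {x y c} → x ^ 2 ≤ c → y ^ 2 ≤ c → (x + y) ^ 2 ≤ 4 * c
x²≤c∧y²≤c⇒[x+y]²≤4c {x} {y} {c} x²≤c y²≤c with ≤-total x y
... | inj₁ x≤y = x≤y∧y²≤c⇒[x+y]²≤4c x≤y y²≤c
... | inj₂ y≤x = subst (λ s → s ^ 2 ≤ 4 * c) (+-comm y x) (x≤y∧y²≤c⇒[x+y]²≤4c y≤x x²≤c)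

k≤p⇒k*p³<[p*[p+1]]² : ∀ {k p} .{{_ : NonZero p}} → k ≤ p → k * p ^ 3 < (p * (p + 1)) ^ 2
k≤p⇒k*p³<[p*[p+1]]² {k} {p} k≤p = begin-strict
  k * p ^ 3          ≤⟨ *-monoˡ-≤ (p ^ 3) k≤p ⟩
  p * p ^ 3          ≡⟨ p⁴≡[p*p]² p ⟩
  (p * p) ^ 2        <⟨ ^-monoˡ-< 2 (*-monoʳ-< p p<p+1) ⟩
  (p * (p + 1)) ^ 2  ∎
  where
  open ≤-Reasoning
  p<p+1 : p < p + 1
  p<p+1 = subst (p <_) (+-comm 1 p) (n<1+n p)
  p⁴≡[p*p]² : ∀ p → p * (p * (p * (p * 1))) ≡ (p * p) * ((p * p) * 1)
  p⁴≡[p*p]² = ℕ-Solver.solve-∀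

HasseBound⇒∣a-b∣<p*[p+1] : ∀ {p a b} → 1600 ≤ p → HasseBound p a → HasseBound p b →
                            ∣ a - b ∣ < p * (p + 1)
HasseBound⇒∣a-b∣<p*[p+1] {p@(suc _)} {a} {b} 1600≤p a-bound b-bound = begin-strict
  ∣ a - b ∣      ≤⟨ ∣i-j∣≤∣i∣+∣j∣ a b ⟩
  ∣ a ∣ + ∣ b ∣  <⟨ ^-cancelˡ-< 2 sum²<[p*[p+1]]² ⟩
  p * (p + 1)    ∎
  where
  open ≤-Reasoning
  sum²<[p*[p+1]]² : (∣ a ∣ + ∣ b ∣) ^ 2 < (p * (p + 1)) ^ 2
  sum²<[p*[p+1]]² = begin-strict
    (∣ a ∣ + ∣ b ∣) ^ 2  ≤⟨ x²≤c∧y²≤c⇒[x+y]²≤4c {∣ a ∣} {∣ b ∣} a-bound b-bound ⟩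
    4 * (400 * p ^ 3)    ≡⟨ *-assoc 4 400 (p ^ 3) ⟨
    1600 * p ^ 3         <⟨ k≤p⇒k*p³<[p*[p+1]]² 1600≤p ⟩
    (p * (p + 1)) ^ 2    ∎

m∣n∧n<m⇒n≡0 : ∀ {m n} → m ℕ.∣ n → n < m → n ≡ 0
m∣n∧n<m⇒n≡0 {n = zero}  _   _   = refl
m∣n∧n<m⇒n≡0 {n = suc _} m∣n n<m = contradiction m∣n (>⇒∤ n<m)

∣i-k∧∣j-k⇒∣j-i : ∀ {m i j k} → m ∣ℤ i - k → m ∣ℤ j - k → m ∣ℤ j - i
∣i-k∧∣j-k⇒∣j-i {m} {i} {j} {k} m∣i-k m∣j-k =
  ∣⇒∣ᵤ (subst (m ∣ₛ_) (difference i j k)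
              (∣m∣n⇒∣m-n {m} {j - k} {i - k} (∣ᵤ⇒∣ m∣j-k) (∣ᵤ⇒∣ m∣i-k)))
  where
  difference : ∀ i j k → (j - k) - (i - k) ≡ j - i
  difference = ℤ-Solver.solve-∀

equal-linear-forms : ∀ c q x y u v → c ℤ.+ x ℤ.* q ℤ.+ y ≡ c ℤ.+ u ℤ.* q ℤ.+ v →
                     y - v ≡ (u - x) ℤ.* q
equal-linear-forms c q x y u v eq = begin
  y - v
    ≡⟨ rearrange c q x y u v ⟩
  (u - x) ℤ.* q ℤ.+ ((c ℤ.+ x ℤ.* q ℤ.+ y) - (c ℤ.+ u ℤ.* q ℤ.+ v))
    ≡⟨ cong (ℤ._+_ ((u - x) ℤ.* q)) (i≡j⇒i-j≡0 eq) ⟩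
  (u - x) ℤ.* q ℤ.+ 0ℤ
    ≡⟨ +-identityʳ _ ⟩
  (u - x) ℤ.* q
    ∎
  where
  open ≡-Reasoning
  rearrange : ∀ c q x y u v →
              y - v ≡ (u - x) ℤ.* q ℤ.+ ((c ℤ.+ x ℤ.* q ℤ.+ y) - (c ℤ.+ u ℤ.* q ℤ.+ v))
  rearrange = ℤ-Solver.solve-∀

N≡⇒a₃-b₃≡[b₂-a₂]*[p+1] : ∀ p a₁ a₂ a₃ b₂ b₃ → N p a₁ a₂ a₃ ≡ N p a₁ b₂ b₃ →
                         a₃ - b₃ ≡ (b₂ - a₂) ℤ.* (+ p ℤ.+ + 1)
N≡⇒a₃-b₃≡[b₂-a₂]*[p+1] p a₁ =
  equal-linear-forms ((+ p) ℤ.^ 3 ℤ.+ + 1 ℤ.+ a₁ ℤ.* ((+ p) ℤ.^ 2 ℤ.+ + 1)) (+ p ℤ.+ + 1)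

mainTheorem3 : (p : ℕ) → Prime p → 1600 ≤ p →
    (a₁ r₂ r₃ a₂ a₃ b₂ b₃ : ℤ) →
    Admissible p r₂ r₃ a₂ a₃ → Admissible p r₂ r₃ b₂ b₃ →
    N p a₁ a₂ a₃ ≡ N p a₁ b₂ b₃ → (a₂ ≡ b₂) × (a₃ ≡ b₃)
mainTheorem3 p _ 1600≤p a₁ r₂ r₃ a₂ a₃ b₂ b₃
             (p∣a₂-r₂ , _ , a₃-bound) (p∣b₂-r₂ , _ , b₃-bound) N≡ =
  sym (i-j≡0⇒i≡j b₂ a₂ δ≡0) ,
  i-j≡0⇒i≡j a₃ b₃ (trans a₃-b₃≡δ*[p+1] (cong (ℤ._* (+ p ℤ.+ + 1)) δ≡0))
  where
  δ : ℤ
  δ = b₂ - a₂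
  a₃-b₃≡δ*[p+1] : a₃ - b₃ ≡ δ ℤ.* (+ p ℤ.+ + 1)
  a₃-b₃≡δ*[p+1] = N≡⇒a₃-b₃≡[b₂-a₂]*[p+1] p a₁ a₂ a₃ b₂ b₃ N≡
  ∣δ∣*[p+1]<p*[p+1] : ∣ δ ∣ * (p + 1) < p * (p + 1)
  ∣δ∣*[p+1]<p*[p+1] =
    subst (_< p * (p + 1)) (trans (cong ∣_∣ a₃-b₃≡δ*[p+1]) (abs-* δ (+ p ℤ.+ + 1)))
          (HasseBound⇒∣a-b∣<p*[p+1] {a = a₃} {b₃} 1600≤p a₃-bound b₃-bound)
  δ≡0 : δ ≡ 0ℤ
  δ≡0 = ∣i∣≡0⇒i≡0 (m∣n∧n<m⇒n≡0 (∣i-k∧∣j-k⇒∣j-i {+ p} {a₂} {b₂} {r₂} p∣a₂-r₂ p∣b₂-r₂)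
                                (*-cancelʳ-< (p + 1) ∣ δ ∣ p ∣δ∣*[p+1]<p*[p+1]))
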